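{- For every integer $n\ge1$, the number of partitions $\lambda$ with $|\lambda|=n$ equals the number of partitions $\lambda$ with $|\lambda|_c=n$.
   Context: A partition is a weakly decreasing finite sequence $\lambda=(\lambda_1\ge\dots\ge\lambda_\ell)$ of positive integers, with Young diagram $D(\lambda)=\{(i,j):1\le i\le\ell,1\le j\le\lambda_i\}$ and area $|\lambda|=\sum_i\lambda_i$. A cell $(i,j)\in D(\lambda)$ is a corner if $(i+1,j)\notin D(\lambda)$ and $(i,j+1)\notin D(\lambda)$; $\mathrm{Cor}(\lambda)$ denotes the set of corners. The cohook area is $|\lambda|_c=\sum_{(i,j)\in\mathrm{Cor}(\lambda)}(i+j-1)$. -}

module Defs where

open import Data.Nat using (ℕ; zero; suc; _+_; _∸_; _≤_; _≥_; _<_; _≤?_)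
open import Data.Nat.Properties using (_≟_)
open import Data.List using (List; []; _∷_; length; map; concatMap; filter; upTo)
open import Data.Nat.ListAction using (sum)
open import Data.List.Relation.Unary.All using (All)
open import Data.List.Relation.Unary.Linked using (Linked)
open import Data.Product using (Σ; _×_; _,_; proj₁)
open import Relation.Nullary using (¬_; Dec)
open import Relation.Nullary.Decidable using (_×-dec_; ¬?)
open import Relation.Binary.PropositionalEquality using (_≡_)

IsPartition : List ℕ → Set
IsPartition l = Linked _≥_ l × All (1 ≤_) l

Partition : Set
Partition = Σ (List ℕ) IsPartition

-- λ_i with 1-based indexing, and 0 beyond the length (and for i = 0).
part : List ℕ → ℕ → ℕ
part []       _             = 0
part (x ∷ xs) zero          = 0
part (x ∷ xs) (suc zero)    = x
part (x ∷ xs) (suc (suc i)) = part xs (suc i)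

Cell : Set
Cell = ℕ × ℕ

InDiagram : List ℕ → Cell → Set
InDiagram l (i , j) = (1 ≤ i × i ≤ length l) × (1 ≤ j × j ≤ part l i)

inDiagram? : (l : List ℕ) → (c : Cell) → Dec (InDiagram l c)
inDiagram? l (i , j) = ((1 ≤? i) ×-dec (i ≤? length l)) ×-dec ((1 ≤? j) ×-dec (j ≤? part l i))

cells : List ℕ → List Cell
cells l = concatMap (λ i → map (λ j → (suc i , suc j)) (upTo (part l (suc i)))) (upTo (length l))

IsCorner : List ℕ → Cell → Set
IsCorner l (i , j) = ¬ InDiagram l (suc i , j) × ¬ InDiagram l (i , suc j)

isCorner? : (l : List ℕ) → (c : Cell) → Dec (IsCorner l c)
isCorner? l (i , j) = ¬? (inDiagram? l (suc i , j)) ×-dec ¬? (inDiagram? l (i , suc j))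

corners : List ℕ → List Cell
corners l = filter (isCorner? l) (cells l)

area : Partition → ℕ
area p = sum (proj₁ p)

cohookArea : Partition → ℕ
cohookArea p = sum (map (λ c → proj₁ c + Data.Product.proj₂ c ∸ 1) (corners (proj₁ p)))

-- Both sides are in weight-preserving bijection with the pairs (μ , N) where μ is a weakly
-- decreasing sequence of k naturals and N is a partition with parts at most k, weighted
-- |μ| + k² + |N|. For the area, k is the side of the Durfee square, μ lists the row lengths to
-- its right and N is the partition below it. For the cohook area, k is the number of corners:
-- reading the rows bottom-up, the j-th corner, in a row of length x, contributes x − j to μ,
-- and every other row contributes to N the number of corners below it. The cohook weight
-- i + x − 1 of a corner in row i splits into x and the number i − 1 of rows above it. Summed
-- over the corners, the lengths x give |μ| + Σⱼ j, and the rows above give Σⱼ (j − 1) + |N|,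
-- because a row with c corners below it is counted c times; together |μ| + k² + |N|.

module Submission where

open import Defs
open import Data.List using (List; []; _∷_; _++_; length; map; concatMap; filter; upTo; applyUpTo)
open import Data.List.Properties
  using (map-++; map-∘; map-cong; map-id; map-id-local; length-map; map-upTo; applyUpTo-∷ʳ;
         concatMap-cong; filter-++; filter-none; filter-accept; filter-reject)
open import Data.List.Relation.Unary.All as All using (All; []; _∷_)
open import Data.List.Relation.Unary.All.Properties using (map⁺; ++⁺; ++⁻ʳ; applyUpTo⁺₁)
open import Data.List.Relation.Unary.Linked as Linked using (Linked; []; [-]; _∷_)
open import Data.List.Relation.Unary.Linked.Properties using () renaming (map⁺ to linked-map⁺)
open import Data.Nat using (ℕ; zero; suc; _+_; _*_; _∸_; _≤_; _≥_; _<_; _<?_; z≤n; s≤s; s≤s⁻¹)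
open import Data.Nat.Properties
  using (_≟_; ≤-refl; ≤-reflexive; ≤-trans; ≤-antisym; ≤-irrelevant; <⇒≤; <⇒≱; ≮⇒≥; ≤∧≢⇒<;
         n≮n; n<1+n; 1+n≰n; m≤n⇒m≤1+n; m≤n+m; +-comm; +-suc; +-identityʳ; *-zeroʳ;
         +-monoˡ-≤; +-mono-≤-<; ∸-monoˡ-≤; m+n∸n≡m; m∸n+n≡m; m+n≤o⇒m≤o∸n)
open import Data.Nat.ListAction using (sum)
open import Data.Nat.ListAction.Properties using (sum-++)
open import Data.Nat.Tactic.RingSolver using (solve-∀)
open import Data.Product using (Σ; _×_; _,_; proj₁; proj₂; uncurry; map₁)
open import Data.Product.Properties using (Σ-≡,≡→≡)
open import Data.Product.Function.Dependent.Propositional using (Σ-↔)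
open import Function using (_∘_)
open import Function.Bundles using (_↔_; mk↔ₛ′; Inverse)
open import Function.Properties.Inverse using (↔-refl; ↔-sym; ↔-trans)
open import Relation.Nullary using (¬_; Irrelevant; yes; no; contradiction)
open import Relation.Unary using (Decidable)
open import Relation.Binary.PropositionalEquality
  using (_≡_; refl; sym; trans; cong; cong₂; subst; module ≡-Reasoning)

open ≡-Reasoning

Decreasing : List ℕ → Set
Decreasing = Linked _≥_

decreasing-head : ∀ {x xs} → Decreasing (x ∷ xs) → part xs 1 ≤ x
decreasing-head [-] = z≤n
decreasing-head (x≥y ∷ _) = x≥y

decreasing-∷ : ∀ {x xs} → part xs 1 ≤ x → Decreasing xs → Decreasing (x ∷ xs)
decreasing-∷ {xs = []} _ _ = [-]
decreasing-∷ {xs = _ ∷ _} x≥y xs↓ = x≥y ∷ xs↓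

decreasing-++ : ∀ {xs ys} → Decreasing xs → Decreasing ys → All (part ys 1 ≤_) xs →
  Decreasing (xs ++ ys)
decreasing-++ {[]} _ ys↓ [] = ys↓
decreasing-++ {_ ∷ []} _ ys↓ (y≤x ∷ []) = decreasing-∷ y≤x ys↓
decreasing-++ {_ ∷ _ ∷ _} (x≥x′ ∷ xs↓) ys↓ (_ ∷ bounds) = x≥x′ ∷ decreasing-++ xs↓ ys↓ bounds

linked-++⁻ : ∀ {A : Set} {R : A → A → Set} xs {ys} →
  Linked R (xs ++ ys) → Linked R xs × Linked R ys
linked-++⁻ [] ys↓ = [] , ys↓
linked-++⁻ (_ ∷ []) xys↓ = [-] , Linked.tail xys↓
linked-++⁻ (_ ∷ x′ ∷ xs) (r ∷ xys↓) = map₁ (r ∷_) (linked-++⁻ (x′ ∷ xs) xys↓)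

∷-isPartition : ∀ {x l} → part l 1 ≤ x → 0 < x → IsPartition l → IsPartition (x ∷ l)
∷-isPartition l₁≤x x>0 (l↓ , l⁺) = decreasing-∷ l₁≤x l↓ , x>0 ∷ l⁺

isPartition-irrelevant : ∀ {l} → Irrelevant (IsPartition l)
isPartition-irrelevant (l↓ , l⁺) (l↓′ , l⁺′) =
  cong₂ _,_ (Linked.irrelevant ≤-irrelevant l↓ l↓′) (All.irrelevant ≤-irrelevant l⁺ l⁺′)

0<m+1+n : ∀ m n → 0 < m + suc n
0<m+1+n m n = ≤-trans (s≤s z≤n) (m≤n+m (suc n) m)

sum-map-+ : ∀ k xs → sum (map (_+ k) xs) ≡ sum xs + length xs * k
sum-map-+ k [] = refl
sum-map-+ k (x ∷ xs) =
  trans (cong (x + k +_) (sum-map-+ k xs)) (regroup x k (sum xs) (length xs * k))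
  where
  regroup : ∀ a b c d → a + b + (c + d) ≡ a + c + (b + d)
  regroup = solve-∀

applyUpTo-cong : ∀ {A : Set} {f g : ℕ → A} → (∀ i → f i ≡ g i) →
  ∀ n → applyUpTo f n ≡ applyUpTo g n
applyUpTo-cong f≗g zero = refl
applyUpTo-cong f≗g (suc n) = cong₂ _∷_ (f≗g 0) (applyUpTo-cong (f≗g ∘ suc) n)

filter-concatMap : ∀ {A B : Set} {P : B → Set} (P? : Decidable P) (f : A → List B) xs →
  filter P? (concatMap f xs) ≡ concatMap (filter P? ∘ f) xs
filter-concatMap P? f [] = refl
filter-concatMap P? f (x ∷ xs) =
  trans (filter-++ P? (f x) (concatMap f xs))
        (cong (filter P? (f x) ++_) (filter-concatMap P? f xs))

sum-map-concatMap : ∀ {A B : Set} (w : B → ℕ) (f : A → List B) xs →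
  sum (map w (concatMap f xs)) ≡ sum (map (sum ∘ map w ∘ f) xs)
sum-map-concatMap w f [] = refl
sum-map-concatMap w f (x ∷ xs) = begin
  sum (map w (f x ++ concatMap f xs))
    ≡⟨ cong sum (map-++ w (f x) (concatMap f xs)) ⟩
  sum (map w (f x) ++ map w (concatMap f xs))
    ≡⟨ sum-++ (map w (f x)) (map w (concatMap f xs)) ⟩
  sum (map w (f x)) + sum (map w (concatMap f xs))
    ≡⟨ cong (sum (map w (f x)) +_) (sum-map-concatMap w f xs) ⟩
  sum (map w (f x)) + sum (map (sum ∘ map w ∘ f) xs) ∎

module _ {A B : Set} {P : A → Set} {Q : B → Set}
         (P-irrelevant : ∀ {a} → Irrelevant (P a)) (Q-irrelevant : ∀ {b} → Irrelevant (Q b)) where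

  Σ-↔-restrict : (f : A → B) (g : B → A) →
    (∀ {a} → P a → Q (f a)) → (∀ {b} → Q b → P (g b)) →
    (∀ {a} → P a → g (f a) ≡ a) → (∀ {b} → Q b → f (g b) ≡ b) →
    Σ A P ↔ Σ B Q
  Σ-↔-restrict f g f-ok g-ok g∘f f∘g = mk↔ₛ′
    (λ (a , p) → f a , f-ok p)
    (λ (b , q) → g b , g-ok q)
    (λ (_ , q) → Σ-≡,≡→≡ (f∘g q , Q-irrelevant _ _))
    (λ (_ , p) → Σ-≡,≡→≡ (g∘f p , P-irrelevant _ _))

≡-↔ : ∀ {a b n : ℕ} → a ≡ b → (a ≡ n) ↔ (b ≡ n)
≡-↔ refl = ↔-refl

fibre-↔ : ∀ {X Y : Set} (e : X ↔ Y) (u : X → ℕ) (v : Y → ℕ) →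
  (∀ x → u x ≡ v (Inverse.to e x)) → ∀ n → Σ X (λ x → u x ≡ n) ↔ Σ Y (λ y → v y ≡ n)
fibre-↔ e u v u≡v n = Σ-↔ e (≡-↔ (u≡v _))

-- (μ , N) stands for the partition made of a k × k square with k = length μ, the rows μ
-- to its right (possibly empty, hence μ may contain zeros) and the partition N below it.
IsDurfeePair : List ℕ × List ℕ → Set
IsDurfeePair (μ , N) = Decreasing μ × IsPartition N × part N 1 ≤ length μ

DurfeePair : Set
DurfeePair = Σ (List ℕ × List ℕ) IsDurfeePair

isDurfeePair-irrelevant : ∀ {v} → Irrelevant (IsDurfeePair v)
isDurfeePair-irrelevant (μ↓ , N-part , N₁≤k) (μ↓′ , N-part′ , N₁≤k′) =
  cong₂ _,_ (Linked.irrelevant ≤-irrelevant μ↓ μ↓′)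
            (cong₂ _,_ (isPartition-irrelevant N-part N-part′) (≤-irrelevant N₁≤k N₁≤k′))

weight : List ℕ × List ℕ → ℕ
weight (μ , N) = sum μ + length μ * length μ + sum N

durfeeWeight : DurfeePair → ℕ
durfeeWeight = weight ∘ proj₁

durfeeJoin : List ℕ × List ℕ → List ℕ
durfeeJoin (μ , N) = map (_+ length μ) μ ++ N

sum-durfeeJoin : ∀ v → sum (durfeeJoin v) ≡ weight v
sum-durfeeJoin (μ , N) = begin
  sum (map (_+ length μ) μ ++ N)       ≡⟨ sum-++ (map (_+ length μ) μ) N ⟩
  sum (map (_+ length μ) μ) + sum N    ≡⟨ cong (_+ sum N) (sum-map-+ (length μ) μ) ⟩
  sum μ + length μ * length μ + sum N  ∎

durfeeJoin-isPartition : ∀ {v} → IsDurfeePair v → IsPartition (durfeeJoin v)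
durfeeJoin-isPartition {μ , N} (μ↓ , (N↓ , N⁺) , N₁≤k) =
  decreasing-++ (linked-map⁺ (Linked.map (+-monoˡ-≤ k) μ↓)) N↓
                (map⁺ (All.universal (λ m → ≤-trans N₁≤k (m≤n+m k m)) μ)) ,
  ++⁺ (shifted-positive μ) N⁺
  where
  k : ℕ
  k = length μ
  shifted-positive : ∀ xs → All (0 <_) (map (_+ length xs) xs)
  shifted-positive [] = []
  shifted-positive xs@(_ ∷ xs′) = map⁺ (All.universal (λ x → 0<m+1+n x (length xs′)) xs)

-- durfeeRows o ρ splits off the rows of ρ meeting the Durfee square, numbering rows from o + 1.
durfeeRows : ℕ → List ℕ → List ℕ × List ℕ
durfeeRows o [] = [] , []
durfeeRows o (x ∷ xs) with o <? x
... | yes _ = map₁ (x ∷_) (durfeeRows (suc o) xs)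
... | no _ = [] , x ∷ xs

removeSquare : List ℕ × List ℕ → List ℕ × List ℕ
removeSquare (H , N) = map (_∸ length H) H , N

durfeeSplit : List ℕ → List ℕ × List ℕ
durfeeSplit = removeSquare ∘ durfeeRows 0

durfeeRows-++ : ∀ o ρ → uncurry _++_ (durfeeRows o ρ) ≡ ρ
durfeeRows-++ o [] = refl
durfeeRows-++ o (x ∷ xs) with o <? x
... | yes _ = cong (x ∷_) (durfeeRows-++ (suc o) xs)
... | no _ = refl

durfeeRows-below : ∀ o ρ →
  part (proj₂ (durfeeRows o ρ)) 1 ≤ o + length (proj₁ (durfeeRows o ρ))
durfeeRows-below o [] = z≤n
durfeeRows-below o (x ∷ xs) with o <? x
... | yes _ = ≤-trans (durfeeRows-below (suc o) xs) (≤-reflexive (sym (+-suc o _)))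
... | no o≮x = ≤-trans (≮⇒≥ o≮x) (≤-reflexive (sym (+-identityʳ o)))

durfeeRows-square : ∀ o ρ → Decreasing ρ →
  All (o + length (proj₁ (durfeeRows o ρ)) ≤_) (proj₁ (durfeeRows o ρ))
durfeeRows-square o [] _ = []
durfeeRows-square o (x ∷ xs) x∷xs↓ with o <? x
... | no _ = []
... | yes o<x with durfeeRows (suc o) xs | durfeeRows-++ (suc o) xs
                 | durfeeRows-square (suc o) xs (Linked.tail x∷xs↓)
...   | [] , _ | _ | [] = ≤-trans (≤-reflexive (+-comm o 1)) o<x ∷ []
...   | _ ∷ _ , _ | refl | square =
  ≤-trans (≤-reflexive (+-suc o _)) (≤-trans (All.head square) (decreasing-head x∷xs↓)) ∷
  All.map (≤-trans (≤-reflexive (+-suc o _))) square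

durfeeRows-durfeeJoin : ∀ o k μ N → length μ + o ≡ k → part N 1 ≤ k →
  durfeeRows o (map (_+ k) μ ++ N) ≡ (map (_+ k) μ , N)
durfeeRows-durfeeJoin o k [] [] _ _ = refl
durfeeRows-durfeeJoin o k [] (n ∷ N) refl n≤o with o <? n
... | yes o<n = contradiction n≤o (<⇒≱ o<n)
... | no _ = refl
durfeeRows-durfeeJoin o k (m ∷ μ) N 1+μ+o≡k N₁≤k with o <? m + k
... | yes _ =
  cong (map₁ (m + k ∷_))
       (durfeeRows-durfeeJoin (suc o) k μ N (trans (+-suc _ o) 1+μ+o≡k) N₁≤k)
... | no o≮m+k = contradiction o<m+k o≮m+k
  where
  o<m+k : o < m + k
  o<m+k = ≤-trans (s≤s (m≤n+m o (length μ))) (≤-trans (≤-reflexive 1+μ+o≡k) (m≤n+m k m))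

map-∸-+ : ∀ k xs → All (k ≤_) xs → map (_+ k) (map (_∸ k) xs) ≡ xs
map-∸-+ k xs k≤xs = trans (sym (map-∘ xs)) (map-id-local (All.map m∸n+n≡m k≤xs))

map-+-∸ : ∀ k xs → map (_∸ k) (map (_+ k) xs) ≡ xs
map-+-∸ k xs = trans (sym (map-∘ xs)) (trans (map-cong (λ x → m+n∸n≡m x k) xs) (map-id xs))

durfeeSplit-isDurfeePair : ∀ {ρ} → IsPartition ρ → IsDurfeePair (durfeeSplit ρ)
durfeeSplit-isDurfeePair {ρ} (ρ↓ , ρ⁺)
  with durfeeRows 0 ρ | durfeeRows-++ 0 ρ | durfeeRows-below 0 ρ
... | H , N | refl | N₁≤k =
  linked-map⁺ (Linked.map (∸-monoˡ-≤ (length H)) (proj₁ (linked-++⁻ H ρ↓))) ,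
  (proj₂ (linked-++⁻ H ρ↓) , ++⁻ʳ H ρ⁺) ,
  ≤-trans N₁≤k (≤-reflexive (sym (length-map (_∸ length H) H)))

durfeeJoin-durfeeSplit : ∀ {ρ} → Decreasing ρ → durfeeJoin (durfeeSplit ρ) ≡ ρ
durfeeJoin-durfeeSplit {ρ} ρ↓
  with durfeeRows 0 ρ | durfeeRows-++ 0 ρ | durfeeRows-square 0 ρ ρ↓
... | H , N | H++N≡ρ | H-square = begin
  map (_+ length (map (_∸ k) H)) (map (_∸ k) H) ++ N
    ≡⟨ cong (λ n → map (_+ n) (map (_∸ k) H) ++ N) (length-map (_∸ k) H) ⟩
  map (_+ k) (map (_∸ k) H) ++ N  ≡⟨ cong (_++ N) (map-∸-+ k H H-square) ⟩
  H ++ N                          ≡⟨ H++N≡ρ ⟩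
  ρ                               ∎
  where
  k : ℕ
  k = length H

durfeeSplit-durfeeJoin : ∀ μ N → part N 1 ≤ length μ →
  durfeeSplit (durfeeJoin (μ , N)) ≡ (μ , N)
durfeeSplit-durfeeJoin μ N N₁≤k = begin
  removeSquare (durfeeRows 0 (map (_+ k) μ ++ N))
    ≡⟨ cong removeSquare (durfeeRows-durfeeJoin 0 k μ N (+-identityʳ k) N₁≤k) ⟩
  map (_∸ length (map (_+ k) μ)) (map (_+ k) μ) , N
    ≡⟨ cong (λ n → map (_∸ n) (map (_+ k) μ) , N) (length-map (_+ k) μ) ⟩
  map (_∸ k) (map (_+ k) μ) , N  ≡⟨ cong (_, N) (map-+-∸ k μ) ⟩
  μ , N                          ∎
  where
  k : ℕ
  k = length μ

durfeeSplitting : Partition ↔ DurfeePair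
durfeeSplitting = Σ-↔-restrict isPartition-irrelevant isDurfeePair-irrelevant
  durfeeSplit durfeeJoin durfeeSplit-isDurfeePair durfeeJoin-isPartition
  (λ p → durfeeJoin-durfeeSplit (proj₁ p))
  (λ {v} (_ , _ , N₁≤k) → durfeeSplit-durfeeJoin (proj₁ v) (proj₂ v) N₁≤k)

area-durfeeSplit : ∀ p → area p ≡ durfeeWeight (Inverse.to durfeeSplitting p)
area-durfeeSplit (ρ , ρ↓ , _) = begin
  sum ρ                                ≡⟨ cong sum (sym (durfeeJoin-durfeeSplit ρ↓)) ⟩
  sum (durfeeJoin (durfeeSplit ρ))     ≡⟨ sum-durfeeJoin (durfeeSplit ρ) ⟩
  weight (durfeeSplit ρ)               ∎

addRow : ℕ → ℕ → List ℕ × List ℕ → List ℕ × List ℕ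
addRow x y (μ , N) with y <? x
... | yes _ = x ∸ suc (length μ) ∷ μ , N
... | no _ = μ , length μ ∷ N

cornerSplit : List ℕ → List ℕ × List ℕ
cornerSplit [] = [] , []
cornerSplit (x ∷ xs) = addRow x (part xs 1) (cornerSplit xs)

addRow-shorter : ∀ {x y} μ N → y < x → addRow x y (μ , N) ≡ (x ∸ suc (length μ) ∷ μ , N)
addRow-shorter {x} {y} μ N y<x with y <? x
... | yes _ = refl
... | no y≮x = contradiction y<x y≮x

addRow-equal : ∀ x μ N → addRow x x (μ , N) ≡ (μ , length μ ∷ N)
addRow-equal x μ N with x <? x
... | yes x<x = contradiction x<x (n≮n x)
... | no _ = refl

-- The inverse of cornerSplit, built top-down: cornerBlock m μ N emits the rows of length
-- m + length (m ∷ μ), one for each leading entry length (m ∷ μ) of N and then the corner.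
cornerJoin : List ℕ → List ℕ → List ℕ
cornerBlock : ℕ → List ℕ → List ℕ → List ℕ

cornerJoin [] _ = []
cornerJoin (m ∷ μ) N = cornerBlock m μ N

cornerBlock m μ [] = m + suc (length μ) ∷ cornerJoin μ []
cornerBlock m μ (n ∷ N) with n ≟ suc (length μ)
... | yes _ = m + suc (length μ) ∷ cornerBlock m μ N
... | no _ = m + suc (length μ) ∷ cornerJoin μ (n ∷ N)

cornerJoin-head : ∀ μ N → part (cornerJoin μ N) 1 ≡ part μ 1 + length μ
cornerJoin-head [] _ = refl
cornerJoin-head (m ∷ μ) [] = refl
cornerJoin-head (m ∷ μ) (n ∷ N) with n ≟ suc (length μ)
... | yes _ = refl
... | no _ = refl

cornerJoin-leg : ∀ μ N → 0 < length μ →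
  cornerJoin μ (length μ ∷ N) ≡ part μ 1 + length μ ∷ cornerJoin μ N
cornerJoin-leg (m ∷ μ) N _ with suc (length μ) ≟ suc (length μ)
... | yes _ = refl
... | no k≢k = contradiction refl k≢k

cornerJoin-corner : ∀ m μ N → part N 1 ≤ length μ →
  cornerJoin (m ∷ μ) N ≡ m + suc (length μ) ∷ cornerJoin μ N
cornerJoin-corner m μ [] _ = refl
cornerJoin-corner m μ (n ∷ N) n≤k with n ≟ suc (length μ)
... | yes refl = contradiction n≤k 1+n≰n
... | no _ = refl

cornerJoin-shorter : ∀ {m μ} N → Decreasing (m ∷ μ) →
  part (cornerJoin μ N) 1 < m + suc (length μ)
cornerJoin-shorter {m} {μ} N m∷μ↓ =
  subst (_< m + suc (length μ)) (sym (cornerJoin-head μ N))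
        (+-mono-≤-< (decreasing-head m∷μ↓) (n<1+n (length μ)))

data LegView (k : ℕ) : List ℕ → Set where
  leg : ∀ N → LegView k (suc k ∷ N)
  corner : ∀ {N} → part N 1 ≤ k → LegView k N

legView : ∀ k N → part N 1 ≤ suc k → LegView k N
legView k [] _ = corner z≤n
legView k (n ∷ N) n≤1+k with n ≟ suc k
... | yes refl = leg N
... | no n≢1+k = corner (s≤s⁻¹ (≤∧≢⇒< n≤1+k n≢1+k))

isDurfeePair-dropLeg : ∀ {μ n N} → IsDurfeePair (μ , n ∷ N) → IsDurfeePair (μ , N)
isDurfeePair-dropLeg (μ↓ , (n∷N↓ , _ ∷ N⁺) , n≤k) =
  μ↓ , (Linked.tail n∷N↓ , N⁺) , ≤-trans (decreasing-head n∷N↓) n≤k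

cornerJoin-isPartition : ∀ μ N → IsDurfeePair (μ , N) → IsPartition (cornerJoin μ N)
cornerJoin-isPartition [] [] _ = [] , []
cornerJoin-isPartition [] (n ∷ N) (_ , (_ , n>0 ∷ _) , n≤0) = contradiction n≤0 (<⇒≱ n>0)
cornerJoin-isPartition (m ∷ μ) N pair@(m∷μ↓ , N-part , N₁≤1+k)
  with legView (length μ) N N₁≤1+k
... | leg N′ =
  subst IsPartition (sym (cornerJoin-leg (m ∷ μ) N′ (s≤s z≤n)))
    (∷-isPartition (≤-reflexive (cornerJoin-head (m ∷ μ) N′)) (0<m+1+n m _)
      (cornerJoin-isPartition (m ∷ μ) N′ (isDurfeePair-dropLeg pair)))
... | corner N₁≤k =
  subst IsPartition (sym (cornerJoin-corner m μ N N₁≤k))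
    (∷-isPartition (<⇒≤ (cornerJoin-shorter N m∷μ↓)) (0<m+1+n m _)
      (cornerJoin-isPartition μ N (Linked.tail m∷μ↓ , N-part , N₁≤k)))

cornerSplit-cornerJoin : ∀ μ N → IsDurfeePair (μ , N) →
  cornerSplit (cornerJoin μ N) ≡ (μ , N)
cornerSplit-cornerJoin [] [] _ = refl
cornerSplit-cornerJoin [] (n ∷ N) (_ , (_ , n>0 ∷ _) , n≤0) = contradiction n≤0 (<⇒≱ n>0)
cornerSplit-cornerJoin (m ∷ μ) N pair@(m∷μ↓ , N-part , N₁≤1+k)
  with legView (length μ) N N₁≤1+k
... | leg N′ = begin
  cornerSplit (cornerJoin (m ∷ μ) (suc (length μ) ∷ N′))
    ≡⟨ cong cornerSplit (cornerJoin-leg (m ∷ μ) N′ (s≤s z≤n)) ⟩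
  addRow x (part J 1) (cornerSplit J)
    ≡⟨ cong₂ (addRow x) (cornerJoin-head (m ∷ μ) N′)
         (cornerSplit-cornerJoin (m ∷ μ) N′ (isDurfeePair-dropLeg pair)) ⟩
  addRow x x (m ∷ μ , N′)      ≡⟨ addRow-equal x (m ∷ μ) N′ ⟩
  m ∷ μ , suc (length μ) ∷ N′  ∎
  where
  x : ℕ
  x = m + suc (length μ)
  J : List ℕ
  J = cornerJoin (m ∷ μ) N′
... | corner N₁≤k = begin
  cornerSplit (cornerJoin (m ∷ μ) N)  ≡⟨ cong cornerSplit (cornerJoin-corner m μ N N₁≤k) ⟩
  addRow x (part J 1) (cornerSplit J)
    ≡⟨ cong (addRow x (part J 1))
         (cornerSplit-cornerJoin μ N (Linked.tail m∷μ↓ , N-part , N₁≤k)) ⟩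
  addRow x (part J 1) (μ , N)  ≡⟨ addRow-shorter μ N (cornerJoin-shorter N m∷μ↓) ⟩
  x ∸ suc (length μ) ∷ μ , N   ≡⟨ cong (λ y → y ∷ μ , N) (m+n∸n≡m m (suc (length μ))) ⟩
  m ∷ μ , N                    ∎
  where
  x : ℕ
  x = m + suc (length μ)
  J : List ℕ
  J = cornerJoin μ N

IsCornerSplit : List ℕ → List ℕ × List ℕ → Set
IsCornerSplit l (μ , N) = IsDurfeePair (μ , N) × cornerJoin μ N ≡ l

length-pos : ∀ μ → 0 < part μ 1 + length μ → 0 < length μ
length-pos (_ ∷ _) _ = s≤s z≤n

cornerSplit-correct : ∀ {l} → IsPartition l → IsCornerSplit l (cornerSplit l)
cornerSplit-correct {[]} _ = ([] , ([] , []) , z≤n) , refl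
cornerSplit-correct {x ∷ xs} (x∷xs↓ , x>0 ∷ xs⁺)
  with cornerSplit xs | cornerSplit-correct (Linked.tail x∷xs↓ , xs⁺) | part xs 1 <? x
... | μ , N | (μ↓ , N-part , N₁≤k) , join≡xs | yes xs₁<x =
  (decreasing-∷ (m+n≤o⇒m≤o∸n (part μ 1) μ₁+k<x) μ↓ , N-part , m≤n⇒m≤1+n N₁≤k) ,
  trans (cornerJoin-corner _ μ N N₁≤k) (cong₂ _∷_ (m∸n+n≡m k<x) join≡xs)
  where
  μ₁+k≡xs₁ : part μ 1 + length μ ≡ part xs 1
  μ₁+k≡xs₁ = trans (sym (cornerJoin-head μ N)) (cong (λ l → part l 1) join≡xs)
  μ₁+k<x : part μ 1 + suc (length μ) ≤ x
  μ₁+k<x = ≤-trans (≤-reflexive (trans (+-suc _ _) (cong suc μ₁+k≡xs₁))) xs₁<x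
  k<x : suc (length μ) ≤ x
  k<x = ≤-trans (m≤n+m _ (part μ 1)) μ₁+k<x
... | μ , N | (μ↓ , (N↓ , N⁺) , N₁≤k) , join≡xs | no xs₁≮x =
  (μ↓ , (decreasing-∷ N₁≤k N↓ , k>0 ∷ N⁺) , ≤-refl) ,
  trans (cornerJoin-leg μ N k>0) (cong₂ _∷_ μ₁+k≡x join≡xs)
  where
  μ₁+k≡x : part μ 1 + length μ ≡ x
  μ₁+k≡x = trans (sym (cornerJoin-head μ N))
             (trans (cong (λ l → part l 1) join≡xs)
                    (≤-antisym (decreasing-head x∷xs↓) (≮⇒≥ xs₁≮x)))
  k>0 : 0 < length μ
  k>0 = length-pos μ (subst (0 <_) (sym μ₁+k≡x) x>0)

cornerSplitting : Partition ↔ DurfeePair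
cornerSplitting = Σ-↔-restrict isPartition-irrelevant isDurfeePair-irrelevant
  cornerSplit (uncurry cornerJoin)
  (λ p → proj₁ (cornerSplit-correct p)) (λ {v} → cornerJoin-isPartition (proj₁ v) (proj₂ v))
  (λ p → proj₂ (cornerSplit-correct p)) (λ {v} → cornerSplit-cornerJoin (proj₁ v) (proj₂ v))

cornerWeight : ℕ → ℕ → ℕ → ℕ
cornerWeight o x y with y <? x
... | yes _ = o + x
... | no _ = 0

cornerWeight-shorter : ∀ o {x y} → y < x → cornerWeight o x y ≡ o + x
cornerWeight-shorter o {x} {y} y<x with y <? x
... | yes _ = refl
... | no y≮x = contradiction y<x y≮x

cornerWeight-equal : ∀ o x → cornerWeight o x x ≡ 0
cornerWeight-equal o x with x <? x
... | yes x<x = contradiction x<x (n≮n x)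
... | no _ = refl

-- The sum of o + i + λᵢ₊₁ over the corner rows i of λ, counting rows from 0: the cohook area
-- of λ moved down by o rows.
cornerSum : ℕ → List ℕ → ℕ
cornerSum o [] = 0
cornerSum o (x ∷ xs) = cornerWeight o x (part xs 1) + cornerSum (suc o) xs

cornerSum-cornerJoin : ∀ o μ N → IsDurfeePair (μ , N) →
  cornerSum o (cornerJoin μ N) ≡ o * length μ + weight (μ , N)
cornerSum-cornerJoin o [] [] _ = sym (trans (+-identityʳ (o * 0)) (*-zeroʳ o))
cornerSum-cornerJoin o [] (n ∷ N) (_ , (_ , n>0 ∷ _) , n≤0) = contradiction n≤0 (<⇒≱ n>0)
cornerSum-cornerJoin o (m ∷ μ) N pair@(m∷μ↓ , N-part , N₁≤1+k)
  with legView (length μ) N N₁≤1+k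
... | leg N′ = begin
  cornerSum o (cornerJoin (m ∷ μ) (K ∷ N′))
    ≡⟨ cong (cornerSum o) (cornerJoin-leg (m ∷ μ) N′ (s≤s z≤n)) ⟩
  cornerWeight o x (part J 1) + cornerSum (suc o) J
    ≡⟨ cong₂ _+_ (trans (cong (cornerWeight o x) (cornerJoin-head (m ∷ μ) N′))
                        (cornerWeight-equal o x))
                 (cornerSum-cornerJoin (suc o) (m ∷ μ) N′ (isDurfeePair-dropLeg pair)) ⟩
  suc o * K + weight (m ∷ μ , N′)  ≡⟨ leg-arithmetic o K (m + sum μ) (K * K) (sum N′) ⟩
  o * K + weight (m ∷ μ , K ∷ N′)  ∎
  where
  K x : ℕ
  K = suc (length μ)
  x = m + K
  J : List ℕ
  J = cornerJoin (m ∷ μ) N′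
  leg-arithmetic : ∀ o K a b c → suc o * K + (a + b + c) ≡ o * K + (a + b + (K + c))
  leg-arithmetic = solve-∀
... | corner N₁≤k = begin
  cornerSum o (cornerJoin (m ∷ μ) N)
    ≡⟨ cong (cornerSum o) (cornerJoin-corner m μ N N₁≤k) ⟩
  cornerWeight o x (part J 1) + cornerSum (suc o) J
    ≡⟨ cong₂ _+_ (cornerWeight-shorter o (cornerJoin-shorter N m∷μ↓))
                 (cornerSum-cornerJoin (suc o) μ N (Linked.tail m∷μ↓ , N-part , N₁≤k)) ⟩
  o + x + (suc o * k + weight (μ , N))  ≡⟨ corner-arithmetic o m k (sum μ) (sum N) ⟩
  o * suc k + weight (m ∷ μ , N)       ∎
  where
  k x : ℕ
  k = length μ
  x = m + suc k
  J : List ℕ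
  J = cornerJoin μ N
  corner-arithmetic : ∀ o m k s t →
    o + (m + suc k) + (suc o * k + (s + k * k + t)) ≡ o * suc k + (m + s + suc k * suc k + t)
  corner-arithmetic = solve-∀

cellWeight : Cell → ℕ
cellWeight c = proj₁ c + proj₂ c ∸ 1

cornerOfRow : ℕ → ℕ → ℕ → List Cell
cornerOfRow i x y with y <? x
... | yes _ = (suc i , x) ∷ []
... | no _ = []

cornerOfRow-weight : ∀ i x y → sum (map cellWeight (cornerOfRow i x y)) ≡ cornerWeight i x y
cornerOfRow-weight i x y with y <? x
... | yes _ = +-identityʳ (i + x)
... | no _ = refl

rowCorner : List ℕ → ℕ → List Cell
rowCorner l i = cornerOfRow i (part l (suc i)) (part l (suc (suc i)))

rowCornerWeight : ℕ → List ℕ → ℕ → ℕ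
rowCornerWeight o l i = cornerWeight (o + i) (part l (suc i)) (part l (suc (suc i)))

part-pos⇒≤length : ∀ l i → 0 < part l i → i ≤ length l
part-pos⇒≤length (_ ∷ _) (suc zero) _ = s≤s z≤n
part-pos⇒≤length (_ ∷ xs) (suc (suc i)) λ>0 = s≤s (part-pos⇒≤length xs (suc i) λ>0)

inDiagram : ∀ l i j → suc j ≤ part l (suc i) → InDiagram l (suc i , suc j)
inDiagram l i j j<λ =
  (s≤s z≤n , part-pos⇒≤length l (suc i) (≤-trans (s≤s z≤n) j<λ)) , (s≤s z≤n , j<λ)

filter-rowCells : ∀ l i m → part l (suc i) ≡ m →
  filter (isCorner? l) (applyUpTo (λ j → (suc i , suc j)) m) ≡
  cornerOfRow i m (part l (suc (suc i)))
filter-rowCells l i zero _ = refl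
filter-rowCells l i (suc m) λ≡1+m = begin
  filter P? (applyUpTo cell (suc m))
    ≡⟨ cong (filter P?) (sym (applyUpTo-∷ʳ cell m)) ⟩
  filter P? (applyUpTo cell m ++ cell m ∷ [])
    ≡⟨ filter-++ P? (applyUpTo cell m) (cell m ∷ []) ⟩
  filter P? (applyUpTo cell m) ++ filter P? (cell m ∷ [])
    ≡⟨ cong (_++ filter P? (cell m ∷ [])) (filter-none P? (applyUpTo⁺₁ cell m interior)) ⟩
  filter P? (cell m ∷ [])
    ≡⟨ last ⟩
  cornerOfRow i (suc m) (part l (suc (suc i))) ∎
  where
  P? : Decidable (IsCorner l)
  P? = isCorner? l
  cell : ℕ → Cell
  cell j = suc i , suc j
  interior : ∀ {j} → j < m → ¬ IsCorner l (cell j)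
  interior {j} j<m (_ , ¬right) =
    ¬right (inDiagram l i (suc j) (subst (suc (suc j) ≤_) (sym λ≡1+m) (s≤s j<m)))
  last : filter P? (cell m ∷ []) ≡ cornerOfRow i (suc m) (part l (suc (suc i)))
  last with part l (suc (suc i)) <? suc m
  ... | yes below<1+m = filter-accept P?
        ( (λ below → <⇒≱ below<1+m (proj₂ (proj₂ below)))
        , (λ right → 1+n≰n (subst (suc (suc m) ≤_) λ≡1+m (proj₂ (proj₂ right)))))
  ... | no below≮1+m =
    filter-reject P? (λ (¬below , _) → ¬below (inDiagram l (suc i) m (≮⇒≥ below≮1+m)))

corners-rowCorner : ∀ l → corners l ≡ concatMap (rowCorner l) (upTo (length l))
corners-rowCorner l = begin
  filter P? (concatMap row (upTo (length l)))
    ≡⟨ filter-concatMap P? row (upTo (length l)) ⟩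
  concatMap (filter P? ∘ row) (upTo (length l))
    ≡⟨ concatMap-cong filter-row (upTo (length l)) ⟩
  concatMap (rowCorner l) (upTo (length l)) ∎
  where
  P? : Decidable (IsCorner l)
  P? = isCorner? l
  cell : ℕ → ℕ → Cell
  cell i j = suc i , suc j
  row : ℕ → List Cell
  row i = map (cell i) (upTo (part l (suc i)))
  filter-row : ∀ i → filter P? (row i) ≡ rowCorner l i
  filter-row i = trans (cong (filter P?) (map-upTo (cell i) (part l (suc i))))
                       (filter-rowCells l i (part l (suc i)) refl)

rowCornerWeight-suc : ∀ o x xs i →
  rowCornerWeight o (x ∷ xs) (suc i) ≡ rowCornerWeight (suc o) xs i
rowCornerWeight-suc o x xs i =
  cong (λ o′ → cornerWeight o′ (part xs (suc i)) (part xs (suc (suc i)))) (+-suc o i)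

sum-rowCornerWeight : ∀ o l → sum (applyUpTo (rowCornerWeight o l) (length l)) ≡ cornerSum o l
sum-rowCornerWeight o [] = refl
sum-rowCornerWeight o (x ∷ xs) =
  cong₂ _+_ (cong (λ o′ → cornerWeight o′ x (part xs 1)) (+-identityʳ o)) (begin
    sum (applyUpTo (rowCornerWeight o (x ∷ xs) ∘ suc) (length xs))
      ≡⟨ cong sum (applyUpTo-cong (rowCornerWeight-suc o x xs) (length xs)) ⟩
    sum (applyUpTo (rowCornerWeight (suc o) xs) (length xs))
      ≡⟨ sum-rowCornerWeight (suc o) xs ⟩
    cornerSum (suc o) xs ∎)

cohookArea-cornerSum : ∀ p → cohookArea p ≡ cornerSum 0 (proj₁ p)
cohookArea-cornerSum (l , _) = begin
  sum (map cellWeight (corners l))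
    ≡⟨ cong (sum ∘ map cellWeight) (corners-rowCorner l) ⟩
  sum (map cellWeight (concatMap (rowCorner l) (upTo (length l))))
    ≡⟨ sum-map-concatMap cellWeight (rowCorner l) (upTo (length l)) ⟩
  sum (map (sum ∘ map cellWeight ∘ rowCorner l) (upTo (length l)))
    ≡⟨ cong sum (map-cong (λ i → cornerOfRow-weight i (part l (suc i)) (part l (suc (suc i))))
                          (upTo (length l))) ⟩
  sum (map (rowCornerWeight 0 l) (upTo (length l)))
    ≡⟨ cong sum (map-upTo (rowCornerWeight 0 l) (length l)) ⟩
  sum (applyUpTo (rowCornerWeight 0 l) (length l))
    ≡⟨ sum-rowCornerWeight 0 l ⟩
  cornerSum 0 l ∎

cohookArea-cornerSplit : ∀ p → cohookArea p ≡ durfeeWeight (Inverse.to cornerSplitting p)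
cohookArea-cornerSplit p@(l , l-part) = begin
  cohookArea p                                      ≡⟨ cohookArea-cornerSum p ⟩
  cornerSum 0 l                                     ≡⟨ cong (cornerSum 0) (sym join≡l) ⟩
  cornerSum 0 (uncurry cornerJoin (cornerSplit l))  ≡⟨ cornerSum-cornerJoin 0 _ _ pair ⟩
  weight (cornerSplit l)                            ∎
  where
  pair : IsDurfeePair (cornerSplit l)
  pair = proj₁ (cornerSplit-correct l-part)
  join≡l : uncurry cornerJoin (cornerSplit l) ≡ l
  join≡l = proj₂ (cornerSplit-correct l-part)

-- Both bijections preserve the weight for every n.
corollary5p4 : (n : ℕ) → 1 ≤ n →
    (Σ Partition (λ p → area p ≡ n)) ↔ (Σ Partition (λ p → cohookArea p ≡ n))
corollary5p4 n _ =
  ↔-trans (fibre-↔ durfeeSplitting area durfeeWeight area-durfeeSplit n)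
          (↔-sym (fibre-↔ cornerSplitting cohookArea durfeeWeight cohookArea-cornerSplit n))
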